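{- For all natural numbers $m$ and $n$, $r(I_{m+1}, L_{n+1}) \leqslant 2 r(I_{m+1}, L_n) + r(I_m, L_{n+1}) - 1$. Furthermore, if an $(I_{m+1}, L_{n+1})$-free oriented graph $D = (V,A)$ has $2 r(I_{m+1}, L_n) + r(I_m, L_{n+1}) - 2$ vertices, then every $v \in V$ satisfies (1) $|N^-(v)| = |N^+(v)| = r(I_{m+1}, L_n) - 1$ and (2) $|I(v)| = r(I_m, L_{n+1}) - 1$.
   Context: An oriented graph is a finite directed graph with no loops in which each pair of distinct vertices is joined by at most one arc. An oriented graph is $(I_m, L_n)$-free if it contains no independent set of $m$ vertices and no set of $n$ vertices inducing a transitive tournament. $r(I_m, L_n)$ is the least natural number $k$ such that no oriented graph on $k$ vertices is $(I_m, L_n)$-free. $N^+(v)$, $N^-(v)$ denote out- and in-neighbourhoods of $v$, and $I(v) = V \setminus (\{v\}\cup N^-(v)\cup N^+(v))$. -}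

module Defs where

open import Data.Nat using (ℕ; suc; _<_)
open import Data.Bool using (Bool; true; false; not; _∧_)
open import Data.Fin using (Fin) renaming (_<_ to _<ᶠ_)
open import Data.Fin.Properties using (_≟_)
open import Data.Fin.Subset using (Subset; ∣_∣)
open import Data.Vec using (tabulate)
open import Data.Product using (Σ; _×_)
open import Function.Definitions using (Injective)
open import Relation.Binary.PropositionalEquality using (_≡_)
open import Relation.Nullary using (¬_; does)

record OrientedGraph (k : ℕ) : Set where
  field
    arc    : Fin k → Fin k → Bool
    irrefl : ∀ v → arc v v ≡ false
    asym   : ∀ u v → arc u v ≡ true → arc v u ≡ false
open OrientedGraph public

HasIndependent : ∀ {k} → OrientedGraph k → ℕ → Set
HasIndependent {k} D m =
  Σ (Fin m → Fin k) λ f → Injective _≡_ _≡_ f × (∀ i j → arc D (f i) (f j) ≡ false)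

HasTransitive : ∀ {k} → OrientedGraph k → ℕ → Set
HasTransitive {k} D n =
  Σ (Fin n → Fin k) λ f → Injective _≡_ _≡_ f × (∀ i j → i <ᶠ j → arc D (f i) (f j) ≡ true)

Free : ∀ {k} → ℕ → ℕ → OrientedGraph k → Set
Free m n D = ¬ HasIndependent D m × ¬ HasTransitive D n

FreeExists : ℕ → ℕ → ℕ → Set
FreeExists m n k = Σ (OrientedGraph k) (Free m n)

IsR : ℕ → ℕ → ℕ → Set
IsR m n r = ¬ FreeExists m n r × (∀ k → k < r → FreeExists m n k)

N⁺ : ∀ {k} → OrientedGraph k → Fin k → Subset k
N⁺ D v = tabulate λ u → arc D v u

N⁻ : ∀ {k} → OrientedGraph k → Fin k → Subset k
N⁻ D v = tabulate λ u → arc D u v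

Iset : ∀ {k} → OrientedGraph k → Fin k → Subset k
Iset D v = tabulate λ u → not (does (u ≟ v)) ∧ not (arc D v u) ∧ not (arc D u v)

-- Fix a vertex v of an (I_{m+1}, L_{n+1})-free oriented graph. A transitive tournament on
-- n out-neighbours of v becomes one on n + 1 vertices when v is put in front, so N⁺(v)
-- induces an (I_{m+1}, L_n)-free graph and |N⁺(v)| < r(I_{m+1}, L_n); reversing every arc
-- gives the same bound for N⁻(v). An independent set of m vertices of I(v) becomes one of
-- m + 1 vertices when v is added, so |I(v)| < r(I_m, L_{n+1}). Since V is the disjoint union
-- of {v}, N⁺(v), N⁻(v) and I(v), this bounds |V| by 2 r(I_{m+1}, L_n) + r(I_m, L_{n+1}) - 2,
-- and a graph of exactly that order must attain all three bounds at every vertex.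
module Submission where

open import Defs
open import Data.Bool using (Bool; true; false; not; _∧_; _∨_)
open import Data.Bool.Properties using (∨-∧-booleanAlgebra)
open import Algebra.Lattice.Properties.BooleanAlgebra ∨-∧-booleanAlgebra using (deMorgan₂)
open import Data.Empty using (⊥-elim)
open import Data.Fin using (Fin; zero; suc; opposite) renaming (_<_ to _<ᶠ_)
open import Data.Fin.Properties using (_≟_; ¬Fin0; toℕ<n; opposite-prop; opposite-involutive)
open import Data.Fin.Subset using (∣_∣)
open import Data.Nat using (ℕ; suc; _+_; _*_; _∸_; _≤_; _≥_; _<_; s≤s; s≤s⁻¹)
open import Data.Nat.Properties
  using (suc-injective; +-suc; +-cancelˡ-≡; +-mono-≤; +-mono-<-≤; ∸-monoʳ-<; <-irrefl; 1+n≰n;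
         ≰⇒>; ≮⇒≥; m≤n⇒m<n∨m≡n)
open import Data.Nat.Tactic.RingSolver using (solve-∀)
open import Data.Product using (Σ; _×_; _,_; proj₁; proj₂)
open import Data.Sum using (inj₁; inj₂)
open import Data.Vec using (tabulate)
open import Data.Vec.Functional using (_∷_)
open import Data.Vec.Properties using (tabulate-cong)
open import Function using (_∘_)
open import Function.Definitions using (Injective)
open import Relation.Binary.PropositionalEquality
  using (_≡_; _≢_; refl; sym; trans; cong; cong₂; subst; module ≡-Reasoning)
open import Relation.Nullary using (¬_; does; yes; no)
import Data.Fin.Properties as Fin

private
  variable
    j k m n r : ℕ

∷-injective : ∀ {A : Set} {x : A} {h : Fin n → A} →
              Injective _≡_ _≡_ h → (∀ i → h i ≢ x) → Injective _≡_ _≡_ (x ∷ h)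
∷-injective h-inj x∉h {zero}  {zero}  _  = refl
∷-injective h-inj x∉h {zero}  {suc j} eq = ⊥-elim (x∉h j (sym eq))
∷-injective h-inj x∉h {suc i} {zero}  eq = ⊥-elim (x∉h i eq)
∷-injective h-inj x∉h {suc i} {suc j} eq = cong suc (h-inj eq)

opposite-injective : Injective _≡_ _≡_ (opposite {n})
opposite-injective {x = i} {j} eq = begin
  i                     ≡⟨ opposite-involutive i ⟨
  opposite (opposite i) ≡⟨ cong opposite eq ⟩
  opposite (opposite j) ≡⟨ opposite-involutive j ⟩
  j                     ∎
  where open ≡-Reasoning

opposite-reverses-< : {i j : Fin n} → i <ᶠ j → opposite j <ᶠ opposite i
opposite-reverses-< {i = i} {j} i<j
  rewrite opposite-prop i | opposite-prop j = ∸-monoʳ-< (s≤s i<j) (toℕ<n j)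

select : (P : Fin k → Bool) → j ≤ ∣ tabulate P ∣ →
         Σ (Fin j → Fin k) λ g → Injective _≡_ _≡_ g × (∀ i → P (g i) ≡ true)
select {j = 0} P _ = (λ ()) , (λ { {()} }) , (λ ())
select {k = suc k} {j = suc j} P j≤ with P zero in P0
... | true with select (P ∘ suc) (s≤s⁻¹ j≤)
...   | g , g-inj , g∈P =
  zero ∷ suc ∘ g , ∷-injective (g-inj ∘ Fin.suc-injective) (λ _ ()) ,
  λ { zero → P0 ; (suc i) → g∈P i }
select {k = suc k} {j = suc j} P j≤ | false with select (P ∘ suc) j≤
...   | g , g-inj , g∈P = suc ∘ g , g-inj ∘ Fin.suc-injective , g∈P

∣tabulate-∨∣ : (P Q : Fin k → Bool) → (∀ u → P u ∧ Q u ≡ false) →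
               ∣ tabulate (λ u → P u ∨ Q u) ∣ ≡ ∣ tabulate P ∣ + ∣ tabulate Q ∣
∣tabulate-∨∣ {0}  P Q disjoint = refl
∣tabulate-∨∣ {suc k} P Q disjoint with P zero | Q zero | disjoint zero
  | ∣tabulate-∨∣ (P ∘ suc) (Q ∘ suc) (disjoint ∘ suc)
... | true  | false | _ | eq = cong suc eq
... | false | true  | _ | eq = trans (cong suc eq) (sym (+-suc _ _))
... | false | false | _ | eq = eq

∣tabulate∣+∣tabulate-not∣ : (P : Fin k → Bool) → ∣ tabulate P ∣ + ∣ tabulate (not ∘ P) ∣ ≡ k
∣tabulate∣+∣tabulate-not∣ {0}  P = refl
∣tabulate∣+∣tabulate-not∣ {suc k} P with P zero | ∣tabulate∣+∣tabulate-not∣ (P ∘ suc)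
... | true  | eq = cong suc eq
... | false | eq = trans (+-suc _ _) (cong suc eq)

∣tabulate-false∣ : ∣ tabulate {n = k} (λ _ → false) ∣ ≡ 0
∣tabulate-false∣ {0}  = refl
∣tabulate-false∣ {suc k} = ∣tabulate-false∣ {k}

∣tabulate-≟∣ : (v : Fin k) → ∣ tabulate (λ u → does (u ≟ v)) ∣ ≡ 1
∣tabulate-≟∣ {suc k} zero    = cong suc (∣tabulate-false∣ {k})
∣tabulate-≟∣         (suc v) = ∣tabulate-≟∣ v

induced : OrientedGraph k → (Fin j → Fin k) → OrientedGraph j
induced D g = record
  { arc    = λ x y → arc D (g x) (g y)
  ; irrefl = irrefl D ∘ g
  ; asym   = λ x y → asym D (g x) (g y)
  }

reverse : OrientedGraph k → OrientedGraph k
reverse D = record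
  { arc    = λ u v → arc D v u
  ; irrefl = irrefl D
  ; asym   = λ u v → asym D v u
  }

emptyGraph : OrientedGraph 0
emptyGraph = record { arc = λ () ; irrefl = λ () ; asym = λ () }

emptyGraph-free : Free (suc m) (suc n) emptyGraph
emptyGraph-free = (λ (f , _) → ¬Fin0 (f zero)) , (λ (f , _) → ¬Fin0 (f zero))

arc⇒≢ : (D : OrientedGraph k) {u w : Fin k} → arc D u w ≡ true → u ≢ w
arc⇒≢ D {u} uw refl with trans (sym uw) (irrefl D u)
... | ()

reverse-free : (D : OrientedGraph k) → Free m n D → Free m n (reverse D)
reverse-free D (noI , noL) =
  (λ (f , f-inj , f-ind) → noI (f , f-inj , λ i j → f-ind j i)) ,
  (λ (f , f-inj , f-tr) → noL (f ∘ opposite , opposite-injective ∘ f-inj ,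
     λ i j i<j → f-tr (opposite j) (opposite i) (opposite-reverses-< i<j)))

NonAdjacent : OrientedGraph k → Fin k → Fin k → Set
NonAdjacent D v u = u ≢ v × arc D v u ≡ false × arc D u v ≡ false

module _ (D : OrientedGraph k) (v : Fin k) {g : Fin j → Fin k} (g-inj : Injective _≡_ _≡_ g) where

  transitive-cone : (∀ i → arc D v (g i) ≡ true) →
                    HasTransitive (induced D g) n → HasTransitive D (suc n)
  transitive-cone v→g (f , f-inj , f-tr) =
    v ∷ g ∘ f , ∷-injective (f-inj ∘ g-inj) (λ i → arc⇒≢ D (v→g (f i)) ∘ sym) , tr
    where
    tr : ∀ i i′ → i <ᶠ i′ → arc D ((v ∷ g ∘ f) i) ((v ∷ g ∘ f) i′) ≡ true
    tr zero    (suc i′) _       = v→g (f i′)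
    tr (suc i) (suc i′) (s≤s p) = f-tr i i′ p

  independent-cone : (∀ i → NonAdjacent D v (g i)) →
                     HasIndependent (induced D g) m → HasIndependent D (suc m)
  independent-cone v∥g (f , f-inj , f-ind) =
    v ∷ g ∘ f , ∷-injective (f-inj ∘ g-inj) (λ i → proj₁ (v∥g (f i))) , ind
    where
    ind : ∀ i i′ → arc D ((v ∷ g ∘ f) i) ((v ∷ g ∘ f) i′) ≡ false
    ind zero    zero     = irrefl D v
    ind zero    (suc i′) = proj₁ (proj₂ (v∥g (f i′)))
    ind (suc i) zero     = proj₂ (proj₂ (v∥g (f i)))
    ind (suc i) (suc i′) = f-ind i i′

  independent-lift : HasIndependent (induced D g) m → HasIndependent D m
  independent-lift (f , f-inj , f-ind) = g ∘ f , f-inj ∘ g-inj , f-ind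

  transitive-lift : HasTransitive (induced D g) n → HasTransitive D n
  transitive-lift (f , f-inj , f-tr) = g ∘ f , f-inj ∘ g-inj , f-tr

∈Iset⇒NonAdjacent : {D : OrientedGraph k} {v u : Fin k} →
              not (does (u ≟ v)) ∧ not (arc D v u) ∧ not (arc D u v) ≡ true → NonAdjacent D v u
∈Iset⇒NonAdjacent {D = D} {v} {u} h with u ≟ v | arc D v u | arc D u v
∈Iset⇒NonAdjacent () | yes _  | _     | _
∈Iset⇒NonAdjacent () | no _   | true  | _
∈Iset⇒NonAdjacent () | no _   | false | true
∈Iset⇒NonAdjacent _  | no u≢v | false | false = u≢v , refl , refl

InducesFree : ℕ → ℕ → (D : OrientedGraph k) → (Fin k → Bool) → Set
InducesFree {k} m n D P =
  ∀ {j} {g : Fin j → Fin k} → Injective _≡_ _≡_ g → (∀ i → P (g i) ≡ true) → Free m n (induced D g)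

inducesFree⇒∣tabulate∣< : (D : OrientedGraph k) → ¬ FreeExists m n r → (P : Fin k → Bool) →
                           InducesFree m n D P → ∣ tabulate P ∣ < r
inducesFree⇒∣tabulate∣< D no-r P free-on-P = ≰⇒> λ r≤∣P∣ →
  let g , g-inj , g∈P = select P r≤∣P∣ in no-r (induced D g , free-on-P g-inj g∈P)

out-degree< : ¬ FreeExists (suc m) n r → (D : OrientedGraph k) → Free (suc m) (suc n) D →
              (v : Fin k) → ∣ N⁺ D v ∣ < r
out-degree< no-r D (noI , noL) v = inducesFree⇒∣tabulate∣< D no-r (arc D v) λ g-inj v→g →
  noI ∘ independent-lift D v g-inj , noL ∘ transitive-cone D v g-inj v→g

in-degree< : ¬ FreeExists (suc m) n r → (D : OrientedGraph k) → Free (suc m) (suc n) D →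
             (v : Fin k) → ∣ N⁻ D v ∣ < r
in-degree< no-r D free = out-degree< no-r (reverse D) (reverse-free D free)

nonNeighbours< : ¬ FreeExists m (suc n) r → (D : OrientedGraph k) → Free (suc m) (suc n) D →
                 (v : Fin k) → ∣ Iset D v ∣ < r
nonNeighbours< no-r D (noI , noL) v = inducesFree⇒∣tabulate∣< D no-r _ λ g-inj g∈I →
  noI ∘ independent-cone D v g-inj (∈Iset⇒NonAdjacent {D = D} ∘ g∈I) , noL ∘ transitive-lift D v g-inj

degree-sum : (D : OrientedGraph k) (v : Fin k) → suc (∣ N⁺ D v ∣ + ∣ N⁻ D v ∣ + ∣ Iset D v ∣) ≡ k
degree-sum {k} D v = begin
  suc (∣ N⁺ D v ∣ + ∣ N⁻ D v ∣) + ∣ Iset D v ∣        ≡⟨ cong₂ _+_ closed-size Iset-complement ⟨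
  ∣ tabulate closed ∣ + ∣ tabulate (not ∘ closed) ∣ ≡⟨ ∣tabulate∣+∣tabulate-not∣ closed ⟩
  k                                                   ∎
  where
  open ≡-Reasoning

  closed : Fin k → Bool
  closed u = does (u ≟ v) ∨ arc D v u ∨ arc D u v

  loopless : ∀ u → does (u ≟ v) ∧ (arc D v u ∨ arc D u v) ≡ false
  loopless u with u ≟ v
  ... | yes refl rewrite irrefl D u = refl
  ... | no _     = refl

  antisymmetric : ∀ u → arc D v u ∧ arc D u v ≡ false
  antisymmetric u with arc D v u in vu
  ... | true  = asym D v u vu
  ... | false = refl

  closed-size : ∣ tabulate closed ∣ ≡ suc (∣ N⁺ D v ∣ + ∣ N⁻ D v ∣)
  closed-size = trans (∣tabulate-∨∣ _ _ loopless)
                      (cong₂ _+_ (∣tabulate-≟∣ v) (∣tabulate-∨∣ _ _ antisymmetric))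

  Iset-complement : ∣ tabulate (not ∘ closed) ∣ ≡ ∣ Iset D v ∣
  Iset-complement = cong ∣_∣ (tabulate-cong λ u →
    trans (deMorgan₂ (does (u ≟ v)) (arc D v u ∨ arc D u v))
          (cong (not (does (u ≟ v)) ∧_) (deMorgan₂ (arc D v u) (arc D u v))))

+-tight : {x x′ y y′ : ℕ} → x ≤ x′ → y ≤ y′ → x + y ≡ x′ + y′ → x ≡ x′ × y ≡ y′
+-tight {x} x≤x′ y≤y′ eq with m≤n⇒m<n∨m≡n x≤x′
... | inj₁ x<x′ = ⊥-elim (<-irrefl eq (+-mono-<-≤ x<x′ y≤y′))
... | inj₂ refl = refl , +-cancelˡ-≡ x _ _ eq

module DegreeBounds {b c : ℕ} (no-b : ¬ FreeExists (suc m) n (suc b)) (no-c : ¬ FreeExists m (suc n) (suc c))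
                    (D : OrientedGraph k) (free : Free (suc m) (suc n) D) (v : Fin k) where

  out≤ : ∣ N⁺ D v ∣ ≤ b
  out≤ = s≤s⁻¹ (out-degree< no-b D free v)

  in≤ : ∣ N⁻ D v ∣ ≤ b
  in≤ = s≤s⁻¹ (in-degree< no-b D free v)

  nonNeighbours≤ : ∣ Iset D v ∣ ≤ c
  nonNeighbours≤ = s≤s⁻¹ (nonNeighbours< no-c D free v)

  order≤ : k ≤ suc (b + b + c)
  order≤ = subst (_≤ _) (degree-sum D v) (s≤s (+-mono-≤ (+-mono-≤ out≤ in≤) nonNeighbours≤))

  tight : k ≡ suc (b + b + c) → ∣ N⁻ D v ∣ ≡ b × ∣ N⁺ D v ∣ ≡ b × ∣ Iset D v ∣ ≡ c
  tight k≡ with +-tight (+-mono-≤ out≤ in≤) nonNeighbours≤ (suc-injective (trans (degree-sum D v) k≡))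
  ... | out+in≡ , I≡ with +-tight out≤ in≤ out+in≡
  ...   | out≡ , in≡ = in≡ , out≡ , I≡

2*[1+b]+[1+c]≡3+[b+b+c] : ∀ b c → 2 * suc b + suc c ≡ 3 + (b + b + c)
2*[1+b]+[1+c]≡3+[b+b+c] = solve-∀

mainTheorem8 : ∀ (m n : ℕ) → m ≥ 1 → n ≥ 1 → ∀ (a b c : ℕ)
    → IsR (suc m) (suc n) a → IsR (suc m) n b → IsR m (suc n) c
    → (a ≤ 2 * b + c ∸ 1)
      × (∀ (D : OrientedGraph (2 * b + c ∸ 2)) → Free (suc m) (suc n) D
           → ∀ v → (∣ N⁻ D v ∣ ≡ b ∸ 1) × (∣ N⁺ D v ∣ ≡ b ∸ 1) × (∣ Iset D v ∣ ≡ c ∸ 1))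
mainTheorem8 (suc m) (suc n) _ _ a 0 c _ (no-b , _) _ = ⊥-elim (no-b (emptyGraph , emptyGraph-free))
mainTheorem8 (suc m) (suc n) _ _ a (suc b) 0 _ _ (no-c , _) = ⊥-elim (no-c (emptyGraph , emptyGraph-free))
mainTheorem8 (suc m) (suc n) _ _ a (suc b) (suc c) (_ , below-a) (no-b , _) (no-c , _) =
  a≤ , λ D free v → DegreeBounds.tight no-b no-c D free v (cong (_∸ 2) order)
  where
  order : 2 * suc b + suc c ≡ 3 + (b + b + c)
  order = 2*[1+b]+[1+c]≡3+[b+b+c] b c

  a≤ : a ≤ 2 * suc b + suc c ∸ 1
  a≤ = ≮⇒≥ λ k<a → too-large (subst (FreeExists _ _) (cong (_∸ 1) order) (below-a _ k<a))
    where
    too-large : ¬ FreeExists (suc (suc m)) (suc (suc n)) (2 + (b + b + c))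
    too-large (D , free) = 1+n≰n (DegreeBounds.order≤ no-b no-c D free zero)
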